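{- Let $\lambda/\mu$ be a skew shape with $n$ cells and let $T\in\mathrm{SYT}(\lambda/\mu)$. Then $\mathrm{Rp}_{\mathrm{SE}}(T)$ is a skew shape contained in the southeast boundary of $\lambda/\mu$. The southeast rotation endpoint $X$ of $T$ and the cell $Y=\mathrm{pos}_T(\min \mathrm{Rc}_{\mathrm{SE}}(T))$ lie in the same connected component $R$ of $\mathrm{Rp}_{\mathrm{SE}}(T)$, and $R$ is one of the following: (a) a hook with northwestern corner $Y$ and southern or eastern endpoint $X$; here $X$ is the southern endpoint if $\mathrm{pos}_T(n)$ is the southwesternmost cell of $\mathrm{Rp}_{\mathrm{SE}}(T)$, and the eastern endpoint if $\mathrm{pos}_T(n)$ is the northeasternmost cell of $\mathrm{Rp}_{\mathrm{SE}}(T)$; (b) a single-column rectangle with northern endpoint $Y$ and southern endpoint $X$; (c) a single-row rectangle with western endpoint $Y$ and eastern endpoint $X$. Moreover, every connected component of $\mathrm{Rp}_{\mathrm{SE}}(T)$ lying strictly northeast of $R$ is a single-row rectangle, and every connected component of $\mathrm{Rp}_{\mathrm{SE}}(T)$ lying strictly southwest of $R$ is a single-column rectangle.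
   Context: Conventions: $\mu\subseteq\lambda$ are partitions, $\lambda/\mu$ is drawn in English notation; cell $(r,c)$ is in row $r$ (rows numbered from top to bottom) and column $c$; "north" means smaller row index, "south" larger row index, "west" smaller column index, "east" larger column index. $n=|\lambda/\mu|$. $\mathrm{SYT}(\lambda/\mu)$ is the set of standard Young tableaux of shape $\lambda/\mu$ (bijective fillings by $\{1,\dots,n\}$ increasing left to right along rows and top to bottom down columns). $\mathrm{pos}_T(x)$ is the cell of $T$ containing $x$. Connected components are taken with respect to edge-adjacency of cells; for two distinct components of a skew shape, all cells of one are strictly north and strictly east of all cells of the other, which orders the components from southwest to northeast. The southeast boundary of $\lambda/\mu$ is the set of cells $(r,c)\in\lambda/\mu$ with $(r+1,c+1)\notin\lambda/\mu$. Within each connected component, the southeast boundary cells form a path in which each cell is the northern or eastern neighbor of the previous one; the southwest-to-northeast order on the southeast boundary lists each component's path in this order, with the components in southwest-to-northeast order. "Southwesternmost", "northeasternmost", and "nonstrictly northeast/southwest" for boundary cells refer to this order. A set $S\subseteq\{1,\dots,n\}$ is southeast min-unimodal in $T$ if all cells $\mathrm{pos}_T(s)$, $s\in S$, lie on the southeast boundary and in a single connected component of $\lambda/\mu$, and the entries of $S$ read in the southwest-to-northeast order of their cells form a sequence that strictly decreases down to $\min S$ and then strictly increases. $\mathrm{Rc}_{\mathrm{SE}}(T)=\{n,n-1,\dots,n-k+1\}$ where $k\ge1$ is maximal such that this set is southeast min-unimodal in $T$; $\mathrm{Rp}_{\mathrm{SE}}(T)=\{\mathrm{pos}_T(x): x\in\mathrm{Rc}_{\mathrm{SE}}(T)\}$.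 Then $\mathrm{pos}_T(n)$ is the southwesternmost or northeasternmost cell of $\mathrm{Rp}_{\mathrm{SE}}(T)$. Let $Y=\mathrm{pos}_T(n-k+1)=(r,c)$. The southeast rotation endpoint $X$ of $T$ is defined as follows. If $\mathrm{pos}_T(n)$ is the southwesternmost cell of $\mathrm{Rp}_{\mathrm{SE}}(T)$: let $r'\ge r$ be maximal with $(r,c),(r+1,c),\dots,(r',c)\in\lambda/\mu$; if $r'>r$ then $X=(r',c)$, otherwise $X=(r,c')$ where $c'\ge c$ is maximal with $(r,c),(r,c+1),\dots,(r,c')\in\lambda/\mu$. If $\mathrm{pos}_T(n)$ is the northeasternmost cell (and $k>1$): let $c'\ge c$ be maximal with $(r,c),\dots,(r,c')\in\lambda/\mu$; if $c'>c$ then $X=(r,c')$, otherwise $X=(r',c)$ with $r'$ maximal with $(r,c),\dots,(r',c)\in\lambda/\mu$. A hook is a connected shape consisting of a single row and a single column joined at the northwest corner. A $1\times1$ square counts as both a single-row and a single-column rectangle. -}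

module Defs where

open import Data.Nat using (ℕ; zero; suc; _+_; _∸_; _≤_; _<_; _≥_)
open import Data.List using (List; []; _∷_)
open import Data.Nat.ListAction using (sum)
open import Data.List.Relation.Unary.Linked using (Linked)
open import Data.Product using (Σ; ∃; ∃-syntax; _×_; _,_; proj₁; proj₂)
open import Data.Sum using (_⊎_)
open import Relation.Nullary using (¬_)
open import Relation.Binary.PropositionalEquality using (_≡_; _≢_)

-- Cells (0-indexed; (r , c) = row r counted from the top, column c
-- counted from the left, English notation).

Cell : Set
Cell = ℕ × ℕ

row : Cell → ℕ
row = proj₁

col : Cell → ℕ
col = proj₂

CellSet : Set₁
CellSet = Cell → Set

SameSet : CellSet → CellSet → Set
SameSet A B = ∀ p → (A p → B p) × (B p → A p)

record Partition : Set where
  constructor mkPartition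
  field
    parts            : List ℕ
    weaklyDecreasing : Linked _≥_ parts
open Partition public

rowLen : List ℕ → ℕ → ℕ
rowLen []       _       = 0
rowLen (x ∷ xs) zero    = x
rowLen (x ∷ xs) (suc r) = rowLen xs r

size : Partition → ℕ
size p = sum (parts p)

_⊆ᴾ_ : Partition → Partition → Set
mu ⊆ᴾ lam = ∀ r → rowLen (parts mu) r ≤ rowLen (parts lam) r

InSkew : Partition → Partition → CellSet
InSkew lam mu (r , c) = rowLen (parts mu) r ≤ c × c < rowLen (parts lam) r

-- n = |lam / mu|  (for mu ⊆ lam)
numCells : Partition → Partition → ℕ
numCells lam mu = size lam ∸ size mu

-- a set of cells is a skew shape (in the same coordinate frame)
IsSkewShape : CellSet → Set
IsSkewShape A = ∃[ lam' ] ∃[ mu' ] (mu' ⊆ᴾ lam' × SameSet A (InSkew lam' mu'))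

-- Standard Young tableaux, given through pos_T : {1..n} → cells

record SYT (lam mu : Partition) : Set where
  field
    pos          : ℕ → Cell
    pos-inShape  : ∀ x → 1 ≤ x → x ≤ numCells lam mu → InSkew lam mu (pos x)
    pos-injective : ∀ x y → 1 ≤ x → x ≤ numCells lam mu → 1 ≤ y → y ≤ numCells lam mu →
                    pos x ≡ pos y → x ≡ y
    pos-surjective : ∀ p → InSkew lam mu p →
                     ∃[ x ] (1 ≤ x × x ≤ numCells lam mu × pos x ≡ p)
    rowIncreasing : ∀ x y → 1 ≤ x → x ≤ numCells lam mu → 1 ≤ y → y ≤ numCells lam mu →
                    row (pos x) ≡ row (pos y) → col (pos x) < col (pos y) → x < y
    colIncreasing : ∀ x y → 1 ≤ x → x ≤ numCells lam mu → 1 ≤ y → y ≤ numCells lam mu →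
                    col (pos x) ≡ col (pos y) → row (pos x) < row (pos y) → x < y
open SYT public

Adj : Cell → Cell → Set
Adj (r , c) (r' , c') =
  (r ≡ r' × (suc c ≡ c' ⊎ suc c' ≡ c)) ⊎ (c ≡ c' × (suc r ≡ r' ⊎ suc r' ≡ r))

data Conn (S : CellSet) : Cell → Cell → Set where
  here : ∀ {a} → S a → Conn S a a
  step : ∀ {a b d} → Conn S a b → Adj b d → S d → Conn S a d

SEBoundary : Partition → Partition → CellSet
SEBoundary lam mu (r , c) = InSkew lam mu (r , c) × ¬ InSkew lam mu (suc r , suc c)

-- On southeast-boundary cells this is exactly the southwest-to-northeast
-- order described in the paper (a total order there).
_⪯_ : Cell → Cell → Set
a ⪯ b = row b ≤ row a × col a ≤ col b

_≺_ : Cell → Cell → Set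
a ≺ b = a ⪯ b × a ≢ b

StrictNE : Cell → Cell → Set
StrictNE q s = row q < row s × col s < col q

module _ (lam mu : Partition) (T : SYT lam mu) where

  private
    n : ℕ
    n = numCells lam mu

  InTop : ℕ → ℕ → Set
  InTop k x = n ∸ k < x × x ≤ n

  -- {n, ..., n-k+1} is southeast min-unimodal in T  (its minimum is n-k+1)
  SEMinUnimodal : ℕ → Set
  SEMinUnimodal k =
      (∀ x → InTop k x → SEBoundary lam mu (pos T x))
    × (∀ x y → InTop k x → InTop k y → Conn (InSkew lam mu) (pos T x) (pos T y))
    × (∀ x y → InTop k x → InTop k y → pos T x ≺ pos T y →
         pos T y ⪯ pos T (suc (n ∸ k)) → y < x)
    × (∀ x y → InTop k x → InTop k y → pos T x ≺ pos T y →
         pos T (suc (n ∸ k)) ⪯ pos T x → x < y)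

  -- k is the size of Rc_SE(T): maximal k ≥ 1 with the above property
  IsRcSize : ℕ → Set
  IsRcSize k = 1 ≤ k × k ≤ n × SEMinUnimodal k
             × (∀ j → 1 ≤ j → j ≤ n → SEMinUnimodal j → j ≤ k)

  -- Rp_SE(T) for |Rc_SE(T)| = k
  Rp : ℕ → CellSet
  Rp k p = ∃[ x ] (InTop k x × pos T x ≡ p)

  NIsSWmost : ℕ → Set
  NIsSWmost k = ∀ p → Rp k p → pos T n ⪯ p

  NIsNEmost : ℕ → Set
  NIsNEmost k = ∀ p → Rp k p → p ⪯ pos T n

ColMax : CellSet → Cell → ℕ → Set
ColMax S (r , c) r' =
    r ≤ r'
  × (∀ i → r ≤ i → i ≤ r' → S (i , c))
  × (∀ r'' → r ≤ r'' → (∀ i → r ≤ i → i ≤ r'' → S (i , c)) → r'' ≤ r')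

RowMax : CellSet → Cell → ℕ → Set
RowMax S (r , c) c' =
    c ≤ c'
  × (∀ j → c ≤ j → j ≤ c' → S (r , j))
  × (∀ c'' → c ≤ c'' → (∀ j → c ≤ j → j ≤ c'' → S (r , j)) → c'' ≤ c')

RuleSW : CellSet → Cell → Cell → Set
RuleSW S (r , c) X = ∃[ r' ] (ColMax S (r , c) r' ×
  ((r < r' × X ≡ (r' , c)) ⊎ (r' ≡ r × ∃[ c' ] (RowMax S (r , c) c' × X ≡ (r , c')))))

RuleNE : CellSet → Cell → Cell → Set
RuleNE S (r , c) X = ∃[ c' ] (RowMax S (r , c) c' ×
  ((c < c' × X ≡ (r , c')) ⊎ (c' ≡ c × ∃[ r' ] (ColMax S (r , c) r' × X ≡ (r' , c)))))

IsSERotationEndpoint : (lam mu : Partition) → SYT lam mu → ℕ → Cell → Set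
IsSERotationEndpoint lam mu T k X =
    (NIsSWmost lam mu T k × RuleSW (InSkew lam mu) Y X)
  ⊎ (NIsNEmost lam mu T k × 1 < k × RuleNE (InSkew lam mu) Y X)
  where
    Y : Cell
    Y = pos T (suc (numCells lam mu ∸ k))

RowSeg : ℕ → ℕ → ℕ → CellSet
RowSeg r c0 c1 p = row p ≡ r × c0 ≤ col p × col p ≤ c1

ColSeg : ℕ → ℕ → ℕ → CellSet
ColSeg c r0 r1 p = col p ≡ c × r0 ≤ row p × row p ≤ r1

IsSingleRowRect : CellSet → Set
IsSingleRowRect A = ∃[ r ] ∃[ c0 ] ∃[ c1 ] (c0 ≤ c1 × SameSet A (RowSeg r c0 c1))

IsSingleColRect : CellSet → Set
IsSingleColRect A = ∃[ c ] ∃[ r0 ] ∃[ r1 ] (r0 ≤ r1 × SameSet A (ColSeg c r0 r1))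

module _ (lam mu : Partition) (T : SYT lam mu) (k : ℕ) (X : Cell) where

  private
    RP : CellSet
    RP = Rp lam mu T k
    Y : Cell
    Y = pos T (suc (numCells lam mu ∸ k))
    r c : ℕ
    r = row Y
    c = col Y
    R : CellSet
    R = Conn RP Y

  CaseHook : Set
  CaseHook = ∃[ r2 ] ∃[ c2 ] (r < r2 × c < c2
    × SameSet R (λ p → RowSeg r c c2 p ⊎ ColSeg c r r2 p)
    × (X ≡ (r2 , c) ⊎ X ≡ (r , c2))
    × (NIsSWmost lam mu T k → X ≡ (r2 , c))
    × (NIsNEmost lam mu T k → X ≡ (r , c2)))

  CaseColumn : Set
  CaseColumn = ∃[ r2 ] (r ≤ r2 × SameSet R (ColSeg c r r2) × X ≡ (r2 , c))

  CaseRow : Set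
  CaseRow = ∃[ c2 ] (c ≤ c2 × SameSet R (RowSeg r c c2) × X ≡ (r , c2))

  SERotationConclusion : Set
  SERotationConclusion =
      IsSkewShape RP
    × (∀ p → RP p → SEBoundary lam mu p)
    × Conn RP Y X
    × (CaseHook ⊎ CaseColumn ⊎ CaseRow)
    × (∀ p → RP p → ¬ Conn RP Y p →
         (∀ q s → Conn RP p q → R s → StrictNE q s) →
         IsSingleRowRect (Conn RP p))
    × (∀ p → RP p → ¬ Conn RP Y p →
         (∀ q s → Conn RP p q → R s → StrictNE s q) →
         IsSingleColRect (Conn RP p))

module Submission where

-- The cells of Rp_SE(T) hold the k largest entries of T.  Entries increase along rows and columns,
-- so these cells form an up-set of λ/μ, i.e. a skew shape λ/μ′, and since they lie on the southeast
-- boundary no two of them are diagonal neighbours.  A vertical edge of Rp_SE(T) weakly northeast of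
-- Y = pos_T(n-k+1) is impossible: unimodality makes the entry of its lower cell the smaller one,
-- column strictness the larger one; dually there is no horizontal edge weakly southwest of Y.  Hence
-- the component of Y is the hook spanned by the maximal column and row runs of λ/μ from Y, and the
-- far ends of its arms are the two candidates for X.  Components strictly northeast of Y have no
-- vertical edge, so they are rows; components strictly southwest of Y are columns.

open import Defs
open import Data.Nat using (ℕ; zero; suc; _+_; _∸_; _≤_; _<_; _≥_; z≤n; s≤s; _≤?_; _<?_)
open import Data.Nat.Properties
open import Data.List using ([]; _∷_; length; applyUpTo)
open import Data.List.Relation.Unary.Linked using (Linked; []; [-]; _∷_)
open import Data.Product using (∃; ∃-syntax; _×_; _,_; proj₁; proj₂; map₂; swap)
open import Data.Sum using (_⊎_; inj₁; inj₂) renaming (swap to ⊎-swap)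
open import Data.Empty using (⊥; ⊥-elim)
open import Relation.Nullary using (¬_; yes; no; contradiction)
open import Relation.Nullary.Decidable using (_×-dec_)
open import Relation.Unary using (Decidable)
open import Relation.Binary.PropositionalEquality

-- ColMax S (r , c) and RowMax S (r , c) unfold to Run along the column and the row of (r , c).
Run : (ℕ → Set) → ℕ → ℕ → Set
Run P a b = a ≤ b × (∀ i → a ≤ i → i ≤ b → P i)
          × (∀ b′ → a ≤ b′ → (∀ i → a ≤ i → i ≤ b′ → P i) → b′ ≤ b)

Run-all : ∀ {P a b} → Run P a b → ∀ i → a ≤ i → i ≤ b → P i
Run-all run = proj₁ (proj₂ run)

Run-unique : ∀ {P a b b′} → Run P a b → Run P a b′ → b ≡ b′
Run-unique (a≤b , Pab , maxb) (a≤b′ , Pab′ , maxb′) =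
  ≤-antisym (maxb′ _ a≤b Pab) (maxb _ a≤b′ Pab′)

Run-singleton : ∀ {P : ℕ → Set} {a} → P a → ¬ P (suc a) → Run P a a
Run-singleton {P} {a} Pa ¬Psa = ≤-refl , (λ i a≤i i≤a → subst P (≤-antisym a≤i i≤a) Pa) , maximal
  where
  maximal : ∀ b → a ≤ b → (∀ i → a ≤ i → i ≤ b → P i) → b ≤ a
  maximal b a≤b Pab with m≤n⇒m<n∨m≡n a≤b
  ... | inj₁ a<b = contradiction (Pab (suc a) (n≤1+n a) a<b) ¬Psa
  ... | inj₂ refl = ≤-refl

Run-extend : ∀ {P : ℕ → Set} {a b} → P a → Run P (suc a) b → Run P a b
Run-extend {P} {a} {b} Pa (a<b , Pab , maxb) = <⇒≤ a<b , all , maximal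
  where
  all : ∀ i → a ≤ i → i ≤ b → P i
  all i a≤i i≤b with m≤n⇒m<n∨m≡n a≤i
  ... | inj₁ a<i = Pab i a<i i≤b
  ... | inj₂ refl = Pa
  maximal : ∀ b′ → a ≤ b′ → (∀ i → a ≤ i → i ≤ b′ → P i) → b′ ≤ b
  maximal b′ a≤b′ Pab′ with m≤n⇒m<n∨m≡n a≤b′
  ... | inj₁ a<b′ = maxb b′ a<b′ (λ i a<i → Pab′ i (<⇒≤ a<i))
  ... | inj₂ refl = <⇒≤ a<b

Run-exists : ∀ {P : ℕ → Set} → Decidable P → ∀ {B} → (∀ {i} → P i → i < B) →
             ∀ {a} → P a → ∃ (Run P a)
Run-exists {P} P? {B} bounded {a} = go B (m≤m+n B a)
  where
  go : ∀ fuel {a} → B ≤ fuel + a → P a → ∃ (Run P a)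
  go zero B≤a Pa = contradiction (bounded Pa) (≤⇒≯ B≤a)
  go (suc fuel) {a} B≤1+fuel+a Pa with P? (suc a)
  ... | yes Psa = map₂ (Run-extend Pa) (go fuel (subst (B ≤_) (sym (+-suc fuel a)) B≤1+fuel+a) Psa)
  ... | no ¬Psa = a , Run-singleton Pa ¬Psa

Run-¬next : ∀ {P : ℕ → Set} {a b} → Run P a b → ¬ P (suc b)
Run-¬next {P} {a} {b} (a≤b , Pab , maxb) Psb = 1+n≰n (maxb (suc b) (m≤n⇒m≤1+n a≤b) all)
  where
  all : ∀ i → a ≤ i → i ≤ suc b → P i
  all i a≤i i≤1+b with m≤n⇒m<n∨m≡n i≤1+b
  ... | inj₁ (s≤s i≤b) = Pab i a≤i i≤b
  ... | inj₂ refl = Psb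

Run-next≤end : ∀ {P : ℕ → Set} {a b j} → Run P a b → j ≤ b → P (suc j) → suc j ≤ b
Run-next≤end run j≤b Psj with m≤n⇒m<n∨m≡n j≤b
... | inj₁ j<b = j<b
... | inj₂ refl = contradiction Psj (Run-¬next run)

Run-restrict : ∀ {P Q : ℕ → Set} {a b} → (∀ {i} → P i → Q i) →
               (∀ i → a ≤ i → i ≤ b → P i) → Run Q a b → Run P a b
Run-restrict P⊆Q Pab (a≤b , _ , maxb) =
  a≤b , Pab , λ b′ a≤b′ Pab′ → maxb b′ a≤b′ (λ i a≤i i≤b′ → P⊆Q (Pab′ i a≤i i≤b′))

LeftRun : (ℕ → Set) → ℕ → ℕ → Set
LeftRun P a b = b ≤ a × (∀ i → b ≤ i → i < a → P i) × (∀ i → suc i ≡ b → ¬ P i)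

leftRun : ∀ {P : ℕ → Set} → Decidable P → ∀ a → ∃ (LeftRun P a)
leftRun P? zero = zero , z≤n , (λ i _ ()) , (λ i ())
leftRun {P} P? (suc a) with P? a
... | no ¬Pa = suc a , ≤-refl , (λ i a<i i≤a → contradiction a<i (<⇒≱ i≤a)) , (λ { i refl → ¬Pa })
... | yes Pa with leftRun P? a
...   | b , b≤a , Pba , stop = b , m≤n⇒m≤1+n b≤a , all , stop
  where
  all : ∀ i → b ≤ i → i < suc a → P i
  all i b≤i i<1+a with m<1+n⇒m<n∨m≡n i<1+a
  ... | inj₁ i<a = Pba i b≤i i<a
  ... | inj₂ refl = Pa

LeftRun-all : ∀ {P a b} → LeftRun P a b → ∀ i → b ≤ i → i < a → P i
LeftRun-all run = proj₁ (proj₂ run)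

LeftRun-start≤ : ∀ {P : ℕ → Set} {a b j} → LeftRun P a b → b ≤ suc j → P j → b ≤ j
LeftRun-start≤ (_ , _ , stop) b≤1+j Pj with m≤n⇒m<n∨m≡n b≤1+j
... | inj₁ (s≤s b≤j) = b≤j
... | inj₂ refl = contradiction Pj (stop _ refl)

LeftRun-below : ∀ {P : ℕ → Set} {a b j} → LeftRun P a b → j < b → ∃[ m ] (j ≤ m × m < a × ¬ P m)
LeftRun-below {b = suc m} (b≤a , _ , stop) (s≤s j≤m) = m , j≤m , b≤a , stop m refl

rowLen-suc : ∀ {xs} → Linked _≥_ xs → ∀ r → rowLen xs (suc r) ≤ rowLen xs r
rowLen-suc []        r       = z≤n
rowLen-suc [-]       zero    = z≤n
rowLen-suc [-]       (suc r) = z≤n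
rowLen-suc (x≥y ∷ _) zero    = x≥y
rowLen-suc (_ ∷ xs≥) (suc r) = rowLen-suc xs≥ r

rowLen-antitone : ∀ {xs} → Linked _≥_ xs → ∀ {i j} → i ≤ j → rowLen xs j ≤ rowLen xs i
rowLen-antitone xs≥ {j = zero}  z≤n   = ≤-refl
rowLen-antitone xs≥ {j = suc j} i≤1+j with m≤n⇒m<n∨m≡n i≤1+j
... | inj₁ (s≤s i≤j) = ≤-trans (rowLen-suc xs≥ j) (rowLen-antitone xs≥ i≤j)
... | inj₂ refl      = ≤-refl

rowLen-beyondLength : ∀ xs {r} → length xs ≤ r → rowLen xs r ≡ 0
rowLen-beyondLength []       _        = refl
rowLen-beyondLength (x ∷ xs) (s≤s le) = rowLen-beyondLength xs le

applyUpTo-linked : ∀ {f : ℕ → ℕ} → (∀ i → f (suc i) ≤ f i) → ∀ L → Linked _≥_ (applyUpTo f L)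
applyUpTo-linked f-anti zero          = []
applyUpTo-linked f-anti (suc zero)    = [-]
applyUpTo-linked f-anti (suc (suc L)) = f-anti 0 ∷ applyUpTo-linked (λ i → f-anti (suc i)) (suc L)

rowLen-applyUpTo : ∀ (f : ℕ → ℕ) L → (∀ i → L ≤ i → f i ≡ 0) →
                   ∀ i → rowLen (applyUpTo f L) i ≡ f i
rowLen-applyUpTo f zero    vanish i       = sym (vanish i z≤n)
rowLen-applyUpTo f (suc L) vanish zero    = refl
rowLen-applyUpTo f (suc L) vanish (suc i) =
  rowLen-applyUpTo (λ i → f (suc i)) L (λ i L≤i → vanish (suc i) (s≤s L≤i)) i

partitionOf : (f : ℕ → ℕ) → (∀ i → f (suc i) ≤ f i) → ℕ → Partition
partitionOf f f-anti L = mkPartition (applyUpTo f L) (applyUpTo-linked f-anti L)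

module _ {lam mu : Partition} where

  InSkew-dec : Decidable (InSkew lam mu)
  InSkew-dec (i , j) = (rowLen (parts mu) i ≤? j) ×-dec (j <? rowLen (parts lam) i)

  InSkew-row<length : ∀ {i j} → InSkew lam mu (i , j) → i < length (parts lam)
  InSkew-row<length {i} {j} (_ , j<λi) with i <? length (parts lam)
  ... | yes i<L = i<L
  ... | no i≮L = contradiction (subst (j <_) (rowLen-beyondLength (parts lam) (≮⇒≥ i≮L)) j<λi) (λ ())

  InSkew-corner : ∀ {p q} → InSkew lam mu p → InSkew lam mu q → row p ≤ row q → col p ≤ col q →
                  InSkew lam mu (row p , col q)
  InSkew-corner (μ≤p , _) (_ , q<λ) rp≤rq cp≤cq =
    ≤-trans μ≤p cp≤cq , <-≤-trans q<λ (rowLen-antitone (weaklyDecreasing lam) rp≤rq)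

_ᵀ : CellSet → CellSet
(C ᵀ) p = C (swap p)

Hook : ℕ → ℕ → ℕ → ℕ → CellSet
Hook r c r2 c2 p = RowSeg r c c2 p ⊎ ColSeg c r r2 p

SameSet-trans : ∀ {A B D : CellSet} → SameSet A B → SameSet B D → SameSet A D
SameSet-trans A≈B B≈D p =
  (λ a → proj₁ (B≈D p) (proj₁ (A≈B p) a)) , (λ d → proj₂ (A≈B p) (proj₂ (B≈D p) d))

Hook-column : ∀ {r c r2 c2} → c2 ≡ c → r ≤ r2 → SameSet (Hook r c r2 c2) (ColSeg c r r2)
Hook-column refl r≤r2 p = flatten , inj₂
  where
  flatten : Hook _ _ _ _ p → ColSeg _ _ _ p
  flatten (inj₁ (refl , c≤j , j≤c)) = ≤-antisym j≤c c≤j , ≤-refl , r≤r2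
  flatten (inj₂ arm) = arm

Hook-row : ∀ {r c r2 c2} → r2 ≡ r → c ≤ c2 → SameSet (Hook r c r2 c2) (RowSeg r c c2)
Hook-row refl c≤c2 p = flatten , inj₁
  where
  flatten : Hook _ _ _ _ p → RowSeg _ _ _ p
  flatten (inj₁ arm) = arm
  flatten (inj₂ (refl , r≤i , i≤r)) = ≤-antisym i≤r r≤i , ≤-refl , c≤c2

Adj-sym : ∀ {a b} → Adj a b → Adj b a
Adj-sym (inj₁ (e , inj₁ x)) = inj₁ (sym e , inj₂ x)
Adj-sym (inj₁ (e , inj₂ x)) = inj₁ (sym e , inj₁ x)
Adj-sym (inj₂ (e , inj₁ x)) = inj₂ (sym e , inj₂ x)
Adj-sym (inj₂ (e , inj₂ x)) = inj₂ (sym e , inj₁ x)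

module _ {C : CellSet} where

  Conn-tgt : ∀ {a b} → Conn C a b → C b
  Conn-tgt (here Ca)     = Ca
  Conn-tgt (step _ _ Cb) = Cb

  Conn-trans : ∀ {a b d} → Conn C a b → Conn C b d → Conn C a d
  Conn-trans ab (here _)         = ab
  Conn-trans ab (step bd adj Cd) = step (Conn-trans ab bd) adj Cd

  Conn-sym : ∀ {a b} → Conn C a b → Conn C b a
  Conn-sym (here Ca)        = here Ca
  Conn-sym (step ab adj Cd) = Conn-trans (step (here Cd) (Adj-sym adj) (Conn-tgt ab)) (Conn-sym ab)

  Conn-ᵀ : ∀ {a b} → Conn C a b → Conn (C ᵀ) (swap a) (swap b)
  Conn-ᵀ (here Ca)        = here Ca
  Conn-ᵀ (step ab adj Cd) = step (Conn-ᵀ ab) (⊎-swap adj) Cd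

  Conn-sameSet : ∀ {a} (A : CellSet) → A a →
                 (∀ {b d} → Conn C a b → A b → Adj b d → C d → A d) →
                 (∀ {q} → A q → Conn C a q) → SameSet (Conn C a) A
  Conn-sameSet {a} A Aa closed connected q = toA , connected
    where
    toA : ∀ {q} → Conn C a q → A q
    toA (here _)         = Aa
    toA (step ab adj Cd) = closed ab (toA ab) adj Cd

  RowSeg-connected : ∀ {r c0 c1} → (∀ {p} → RowSeg r c0 c1 p → C p) →
                     ∀ {q} → RowSeg r c0 c1 q → Conn C (r , c0) q
  RowSeg-connected {r} {c0} {c1} inC (refl , c0≤j , j≤c1) = walk c0≤j j≤c1
    where
    walk : ∀ {j} → c0 ≤ j → j ≤ c1 → Conn C (r , c0) (r , j)
    walk {zero} z≤n j≤c1 = here (inC (refl , z≤n , j≤c1))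
    walk {suc j} c0≤1+j j<c1 with m≤n⇒m<n∨m≡n c0≤1+j
    ... | inj₁ (s≤s c0≤j) =
      step (walk c0≤j (<⇒≤ j<c1)) (inj₁ (refl , inj₁ refl)) (inC (refl , c0≤1+j , j<c1))
    ... | inj₂ refl = here (inC (refl , c0≤1+j , j<c1))

ColSeg-connected : ∀ {C c r0 r1} → (∀ {p} → ColSeg c r0 r1 p → C p) →
                   ∀ {q} → ColSeg c r0 r1 q → Conn C (r0 , c) q
ColSeg-connected {C} inC q∈ = Conn-ᵀ (RowSeg-connected {C ᵀ} (λ {p} → inC {swap p}) q∈)

rowComponent : ∀ {C : CellSet} {bound : ℕ → ℕ} → Decidable C → (∀ {i j} → C (i , j) → j < bound i) →
               ∀ {p} → C p → (∀ i j → Conn C p (i , j) → Conn C p (suc i , j) → ⊥) →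
               IsSingleRowRect (Conn C p)
rowComponent {C} C? bounded {r , c} Cp noVertical =
  r , c0 , c1 , ≤-trans c0≤c c≤c1 ,
  Conn-sameSet (RowSeg r c0 c1) (refl , c0≤c , c≤c1) closed connected
  where
  westRun : ∃ (LeftRun (λ j → C (r , j)) (suc c))
  westRun = leftRun (λ j → C? (r , j)) (suc c)
  eastRun : ∃ (Run (λ j → C (r , j)) c)
  eastRun = Run-exists (λ j → C? (r , j)) bounded Cp
  c0 c1 : ℕ
  c0 = proj₁ westRun
  c1 = proj₁ eastRun
  c0≤c : c0 ≤ c
  c0≤c = LeftRun-start≤ (proj₂ westRun) (proj₁ (proj₂ westRun)) Cp
  c≤c1 : c ≤ c1
  c≤c1 = proj₁ (proj₂ eastRun)
  inC : ∀ {q} → RowSeg r c0 c1 q → C q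
  inC {_ , j} (refl , c0≤j , j≤c1) with j ≤? c
  ... | yes j≤c = LeftRun-all (proj₂ westRun) j c0≤j (s≤s j≤c)
  ... | no j≰c  = Run-all (proj₂ eastRun) j (<⇒≤ (≰⇒> j≰c)) j≤c1
  connected : ∀ {q} → RowSeg r c0 c1 q → Conn C (r , c) q
  connected q∈ = Conn-trans (Conn-sym (RowSeg-connected inC (refl , c0≤c , c≤c1))) (RowSeg-connected inC q∈)
  closed : ∀ {b d} → Conn C (r , c) b → RowSeg r c0 c1 b → Adj b d → C d → RowSeg r c0 c1 d
  closed _ (refl , c0≤j , j≤c1) (inj₁ (refl , inj₁ refl)) Cd =
    refl , m≤n⇒m≤1+n c0≤j , Run-next≤end (proj₂ eastRun) j≤c1 Cd
  closed _ (refl , c0≤j , j≤c1) (inj₁ (refl , inj₂ refl)) Cd =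
    refl , LeftRun-start≤ (proj₂ westRun) c0≤j Cd , <⇒≤ j≤c1
  closed b∈ _ adj@(inj₂ (refl , inj₁ refl)) Cd = ⊥-elim (noVertical _ _ b∈ (step b∈ adj Cd))
  closed b∈ _ adj@(inj₂ (refl , inj₂ refl)) Cd = ⊥-elim (noVertical _ _ (step b∈ adj Cd) b∈)

colComponent : ∀ {C : CellSet} {bound : ℕ → ℕ} → Decidable C → (∀ {i j} → C (i , j) → i < bound j) →
               ∀ {p} → C p → (∀ i j → Conn C p (i , j) → Conn C p (i , suc j) → ⊥) →
               IsSingleColRect (Conn C p)
colComponent {C} C? bounded {p} Cp noHorizontal
  with rowComponent {C ᵀ} (λ q → C? (swap q)) bounded Cp
         (λ i j left right → noHorizontal j i (Conn-ᵀ left) (Conn-ᵀ right))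
... | c , r0 , r1 , r0≤r1 , same =
  c , r0 , r1 , r0≤r1 ,
  λ q → (λ q∈ → proj₁ (same (swap q)) (Conn-ᵀ q∈)) , (λ q∈ → Conn-ᵀ (proj₂ (same (swap q)) q∈))

NoDiagonalPair : CellSet → Set
NoDiagonalPair C = ∀ i j → C (i , j) → ¬ C (suc i , suc j)

NoVerticalEdgeNE : CellSet → Cell → Set
NoVerticalEdgeNE C (r , c) = ∀ i j → suc i ≤ r → c ≤ j → C (i , j) → ¬ C (suc i , j)

NoHorizontalEdgeSW : CellSet → Cell → Set
NoHorizontalEdgeSW C (r , c) = ∀ i j → r ≤ i → suc j ≤ c → C (i , j) → ¬ C (i , suc j)

hookRowArmStep : ∀ {C r c r2 c2} → NoDiagonalPair C → NoVerticalEdgeNE C (r , c) →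
                 NoHorizontalEdgeSW C (r , c) → Run (λ j → C (r , j)) c c2 → Run (λ i → C (i , c)) r r2 →
                 ∀ {b d} → RowSeg r c c2 b → C b → Adj b d → C d → Hook r c r2 c2 d
hookRowArmStep _ _ _ rowRun _ (refl , c≤j , j≤c2) _ (inj₁ (refl , inj₁ refl)) Cd =
  inj₁ (refl , m≤n⇒m≤1+n c≤j , Run-next≤end rowRun j≤c2 Cd)
hookRowArmStep _ _ noLeft _ _ (refl , c≤j , j≤c2) Cb (inj₁ (refl , inj₂ refl)) Cd
  with m≤n⇒m<n∨m≡n c≤j
... | inj₁ (s≤s c≤j′) = inj₁ (refl , c≤j′ , <⇒≤ j≤c2)
... | inj₂ refl       = ⊥-elim (noLeft _ _ ≤-refl ≤-refl Cd Cb)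
hookRowArmStep noDiag _ _ rowRun colRun (refl , c≤j , j≤c2) _ (inj₂ (refl , inj₁ refl)) Cd
  with m≤n⇒m<n∨m≡n c≤j
... | inj₁ (s≤s c≤j′) = ⊥-elim (noDiag _ _ (Run-all rowRun _ c≤j′ (<⇒≤ j≤c2)) Cd)
... | inj₂ refl       = inj₂ (refl , n≤1+n _ , Run-next≤end colRun (proj₁ colRun) Cd)
hookRowArmStep _ noUp _ _ _ (i≡r , c≤j , _) Cb (inj₂ (refl , inj₂ refl)) Cd =
  ⊥-elim (noUp _ _ (≤-reflexive i≡r) c≤j Cd Cb)

hookColumnArmStep : ∀ {C r c r2 c2} → NoDiagonalPair C → NoVerticalEdgeNE C (r , c) →
                    NoHorizontalEdgeSW C (r , c) → Run (λ j → C (r , j)) c c2 → Run (λ i → C (i , c)) r r2 →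
                    ∀ {b d} → ColSeg c r r2 b → C b → Adj b d → C d → Hook r c r2 c2 d
hookColumnArmStep {C} noDiag noUp noLeft rowRun colRun b∈ Cb adj Cd =
  ⊎-swap (hookRowArmStep {C ᵀ} (λ i j → noDiag j i) (λ i j i<c r≤j → noLeft j i r≤j i<c)
            (λ i j c≤i j<r → noUp j i j<r c≤i) colRun rowRun b∈ Cb (⊎-swap adj) Cd)

hookComponent : ∀ {C r c r2 c2} → NoDiagonalPair C → NoVerticalEdgeNE C (r , c) →
                NoHorizontalEdgeSW C (r , c) → Run (λ j → C (r , j)) c c2 → Run (λ i → C (i , c)) r r2 →
                SameSet (Conn C (r , c)) (Hook r c r2 c2)
hookComponent {C} {r} {c} {r2} {c2} noDiag noUp noLeft rowRun colRun =
  Conn-sameSet (Hook r c r2 c2) (inj₁ (refl , ≤-refl , proj₁ rowRun)) closed connected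
  where
  closed : ∀ {b d} → Conn C (r , c) b → Hook r c r2 c2 b → Adj b d → C d → Hook r c r2 c2 d
  closed b∈ (inj₁ arm) = hookRowArmStep noDiag noUp noLeft rowRun colRun arm (Conn-tgt b∈)
  closed b∈ (inj₂ arm) = hookColumnArmStep noDiag noUp noLeft rowRun colRun arm (Conn-tgt b∈)
  connected : ∀ {q} → Hook r c r2 c2 q → Conn C (r , c) q
  connected (inj₁ arm) = RowSeg-connected (λ { (refl , c≤j , j≤c2) → Run-all rowRun _ c≤j j≤c2 }) arm
  connected (inj₂ arm) = ColSeg-connected (λ { (refl , r≤i , i≤r2) → Run-all colRun _ r≤i i≤r2 }) arm

module _ {lam mu : Partition} (T : SYT lam mu) where

  InRange : ℕ → Set
  InRange x = 1 ≤ x × x ≤ numCells lam mu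

  entry-≤-alongRow : ∀ {x y} → InRange x → InRange y → row (pos T x) ≡ row (pos T y) →
                     col (pos T x) ≤ col (pos T y) → x ≤ y
  entry-≤-alongRow (1≤x , x≤n) (1≤y , y≤n) same cx≤cy with m≤n⇒m<n∨m≡n cx≤cy
  ... | inj₁ cx<cy = <⇒≤ (rowIncreasing T _ _ 1≤x x≤n 1≤y y≤n same cx<cy)
  ... | inj₂ cx≡cy = ≤-reflexive (pos-injective T _ _ 1≤x x≤n 1≤y y≤n (cong₂ _,_ same cx≡cy))

  entry-≤-alongColumn : ∀ {x y} → InRange x → InRange y → col (pos T x) ≡ col (pos T y) →
                        row (pos T x) ≤ row (pos T y) → x ≤ y
  entry-≤-alongColumn (1≤x , x≤n) (1≤y , y≤n) same rx≤ry with m≤n⇒m<n∨m≡n rx≤ry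
  ... | inj₁ rx<ry = <⇒≤ (colIncreasing T _ _ 1≤x x≤n 1≤y y≤n same rx<ry)
  ... | inj₂ rx≡ry = ≤-reflexive (pos-injective T _ _ 1≤x x≤n 1≤y y≤n (cong₂ _,_ rx≡ry same))

  -- Compare both entries with the entry z in the cell (row of x, column of y).
  entry-monotone : ∀ {x y} → InRange x → InRange y → row (pos T x) ≤ row (pos T y) →
                   col (pos T x) ≤ col (pos T y) → x ≤ y
  entry-monotone {x} {y} x∈@(1≤x , x≤n) y∈@(1≤y , y≤n) rx≤ry cx≤cy
    with pos-surjective T _ (InSkew-corner {lam} {mu} (pos-inShape T x 1≤x x≤n) (pos-inShape T y 1≤y y≤n)
                                            rx≤ry cx≤cy)
  ... | z , 1≤z , z≤top , z↦corner =
    ≤-trans (entry-≤-alongRow x∈ (1≤z , z≤top) (sym (cong row z↦corner))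
                              (subst (col (pos T x) ≤_) (sym (cong col z↦corner)) cx≤cy))
            (entry-≤-alongColumn (1≤z , z≤top) y∈ (cong col z↦corner)
                                 (subst (_≤ row (pos T y)) (sym (cong row z↦corner)) rx≤ry))

module SoutheastRotation {lam mu : Partition} (T : SYT lam mu) {k : ℕ}
  (0<k : 0 < k) (k≤n : k ≤ numCells lam mu) (sem : SEMinUnimodal lam mu T k) where

  private
    n L : ℕ
    n = numCells lam mu
    L = length (parts lam)
    λr : ℕ → ℕ
    λr = rowLen (parts lam)
    Shape RP : CellSet
    Shape = InSkew lam mu
    RP = Rp lam mu T k
    Y : Cell
    Y = pos T (suc (n ∸ k))
    r c : ℕ
    r = row Y
    c = col Y

    InTop⇒InRange : ∀ {x} → InTop lam mu T k x → InRange T x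
    InTop⇒InRange (n-k<x , x≤n) = ≤-trans (s≤s z≤n) n-k<x , x≤n

    InTop⇒1≤ : ∀ {x} → InTop lam mu T k x → 1 ≤ x
    InTop⇒1≤ top = proj₁ (InTop⇒InRange top)

    onBoundary : ∀ x → InTop lam mu T k x → SEBoundary lam mu (pos T x)
    onBoundary = proj₁ sem

    decreasingSW : ∀ x y → InTop lam mu T k x → InTop lam mu T k y →
                   pos T x ≺ pos T y → pos T y ⪯ Y → y < x
    decreasingSW = proj₁ (proj₂ (proj₂ sem))

    increasingNE : ∀ x y → InTop lam mu T k x → InTop lam mu T k y →
                   pos T x ≺ pos T y → Y ⪯ pos T x → x < y
    increasingNE = proj₂ (proj₂ (proj₂ sem))

  Rp⊆Shape : ∀ {p} → RP p → Shape p
  Rp⊆Shape (x , top , refl) = pos-inShape T x (InTop⇒1≤ top) (proj₂ top)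

  Rp-onBoundary : ∀ p → RP p → SEBoundary lam mu p
  Rp-onBoundary _ (x , top , refl) = onBoundary x top

  Y∈Rp : RP Y
  Y∈Rp = suc (n ∸ k) , (≤-refl , ∸-monoʳ-< 0<k k≤n) , refl

  Rp-dec : Decidable RP
  Rp-dec p with InSkew-dec {lam} {mu} p
  ... | no p∉ = no (λ p∈ → p∉ (Rp⊆Shape p∈))
  ... | yes p∈ with pos-surjective T p p∈
  ...   | x , 1≤x , x≤n , refl with n ∸ k <? x
  ...     | yes n-k<x = yes (x , (n-k<x , x≤n) , refl)
  ...     | no n-k≮x  = no λ { (y , y-top , y↦x) →
              n-k≮x (subst (n ∸ k <_) (pos-injective T y x (InTop⇒1≤ y-top) (proj₂ y-top) 1≤x x≤n y↦x)
                           (proj₁ y-top)) }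

  Rp-upClosed : ∀ {q p} → RP q → Shape p → row q ≤ row p → col q ≤ col p → RP p
  Rp-upClosed {p = p} (x , top , refl) p∈ rq≤rp cq≤cp with pos-surjective T p p∈
  ... | y , 1≤y , y≤n , refl =
    y , (<-≤-trans (proj₁ top) (entry-monotone T (InTop⇒InRange top) (1≤y , y≤n) rq≤rp cq≤cp) , y≤n)
      , refl

  Rp-noDiagonal : NoDiagonalPair RP
  Rp-noDiagonal i j ij∈ sij∈ = proj₂ (Rp-onBoundary _ ij∈) (Rp⊆Shape sij∈)

  Rp-noVerticalNE : NoVerticalEdgeNE RP Y
  Rp-noVerticalNE i j i<r c≤j (y , y-top , y↦) (x , x-top , x↦) = <-asym x<y y<x
    where
    x<y : x < y
    x<y = increasingNE x y x-top y-top (subst₂ _≺_ (sym x↦) (sym y↦) ((n≤1+n i , ≤-refl) , λ ()))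
                                       (subst (Y ⪯_) (sym x↦) (i<r , c≤j))
    y<x : y < x
    y<x = colIncreasing T y x (InTop⇒1≤ y-top) (proj₂ y-top) (InTop⇒1≤ x-top) (proj₂ x-top)
            (trans (cong col y↦) (sym (cong col x↦)))
            (subst₂ _<_ (sym (cong row y↦)) (sym (cong row x↦)) (n<1+n i))

  Rp-noHorizontalSW : NoHorizontalEdgeSW RP Y
  Rp-noHorizontalSW i j r≤i j<c (x , x-top , x↦) (y , y-top , y↦) = <-asym x<y y<x
    where
    y<x : y < x
    y<x = decreasingSW x y x-top y-top (subst₂ _≺_ (sym x↦) (sym y↦) ((≤-refl , n≤1+n j) , λ ()))
                                       (subst (_⪯ Y) (sym y↦) (r≤i , j<c))
    x<y : x < y
    x<y = rowIncreasing T x y (InTop⇒1≤ x-top) (proj₂ x-top) (InTop⇒1≤ y-top) (proj₂ y-top)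
            (trans (cong row x↦) (sym (cong row y↦)))
            (subst₂ _<_ (sym (cong col x↦)) (sym (cong col y↦)) (n<1+n j))

  -- μ′ i is the west end of row i of Rp_SE(T), which is therefore λ/μ′.
  private
    westEnd : ∀ i → ∃ (LeftRun (λ j → RP (i , j)) (λr i))
    westEnd i = leftRun (λ j → Rp-dec (i , j)) (λr i)

    μ′ : ℕ → ℕ
    μ′ i = proj₁ (westEnd i)

    μ′≤λ : ∀ i → μ′ i ≤ λr i
    μ′≤λ i = proj₁ (proj₂ (westEnd i))

    Rp-fromWestEnd : ∀ {i j} → μ′ i ≤ j → j < λr i → RP (i , j)
    Rp-fromWestEnd {i} {j} = LeftRun-all (proj₂ (westEnd i)) j

    Rp⇒μ′≤ : ∀ {i j} → RP (i , j) → μ′ i ≤ j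
    Rp⇒μ′≤ {i} {j} ij∈ with μ′ i ≤? j
    ... | yes μ′≤j = μ′≤j
    ... | no μ′≰j with LeftRun-below (proj₂ (westEnd i)) (≰⇒> μ′≰j)
    ...   | m , j≤m , m<λ , m∉ =
      contradiction (Rp-upClosed ij∈ (≤-trans (proj₁ (Rp⊆Shape ij∈)) j≤m , m<λ) ≤-refl j≤m) m∉

    μ′-antitone : ∀ i → μ′ (suc i) ≤ μ′ i
    μ′-antitone i with μ′ i <? λr (suc i)
    ... | no μ′≮λ = ≤-trans (μ′≤λ (suc i)) (≮⇒≥ μ′≮λ)
    ... | yes μ′<λ = Rp⇒μ′≤ (Rp-upClosed west∈ below∈ (n≤1+n i) ≤-refl)
      where
      west∈ : RP (i , μ′ i)
      west∈ = Rp-fromWestEnd ≤-refl (<-≤-trans μ′<λ (rowLen-suc (weaklyDecreasing lam) i))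
      below∈ : Shape (suc i , μ′ i)
      below∈ = ≤-trans (rowLen-suc (weaklyDecreasing mu) i) (proj₁ (Rp⊆Shape west∈)) , μ′<λ

    μ′-vanishes : ∀ i → L ≤ i → μ′ i ≡ 0
    μ′-vanishes i L≤i = n≤0⇒n≡0 (subst (μ′ i ≤_) (rowLen-beyondLength (parts lam) L≤i) (μ′≤λ i))

  Rp-isSkewShape : IsSkewShape RP
  Rp-isSkewShape = lam , mu′ , (λ i → subst (_≤ λr i) (sym (mu′-rowLen i)) (μ′≤λ i)) , same
    where
    mu′ : Partition
    mu′ = partitionOf μ′ μ′-antitone L
    mu′-rowLen : ∀ i → rowLen (parts mu′) i ≡ μ′ i
    mu′-rowLen = rowLen-applyUpTo μ′ L μ′-vanishes
    same : SameSet RP (InSkew lam mu′)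
    same (i , j) =
        (λ ij∈ → subst (_≤ j) (sym (mu′-rowLen i)) (Rp⇒μ′≤ ij∈) , proj₂ (Rp⊆Shape ij∈))
      , (λ { (μ′≤j , j<λ) → Rp-fromWestEnd (subst (_≤ j) (mu′-rowLen i) μ′≤j) j<λ })

  columnRun : ∃ (Run (λ i → Shape (i , c)) r)
  columnRun = Run-exists (λ i → InSkew-dec {lam} {mu} (i , c)) (InSkew-row<length {lam} {mu}) (Rp⊆Shape Y∈Rp)

  rowRun : ∃ (Run (λ j → Shape (r , j)) c)
  rowRun = Run-exists (λ j → InSkew-dec {lam} {mu} (r , j)) proj₂ (Rp⊆Shape Y∈Rp)

  private
    r2 c2 : ℕ
    r2 = proj₁ columnRun
    c2 = proj₁ rowRun
    r≤r2 : r ≤ r2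
    r≤r2 = proj₁ (proj₂ columnRun)
    c≤c2 : c ≤ c2
    c≤c2 = proj₁ (proj₂ rowRun)

  Y-component : SameSet (Conn RP Y) (Hook r c r2 c2)
  Y-component = hookComponent Rp-noDiagonal Rp-noVerticalNE Rp-noHorizontalSW
    (Run-restrict Rp⊆Shape
       (λ j c≤j j≤c2 → Rp-upClosed Y∈Rp (Run-all (proj₂ rowRun) j c≤j j≤c2) ≤-refl c≤j) (proj₂ rowRun))
    (Run-restrict Rp⊆Shape
       (λ i r≤i i≤r2 → Rp-upClosed Y∈Rp (Run-all (proj₂ columnRun) i r≤i i≤r2) r≤i ≤-refl) (proj₂ columnRun))

  Outcome : Cell → Set
  Outcome X = Conn RP Y X × (CaseHook lam mu T k X ⊎ CaseColumn lam mu T k X ⊎ CaseRow lam mu T k X)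

  private
    south∈ : Conn RP Y (r2 , c)
    south∈ = proj₂ (Y-component _) (inj₂ (refl , r≤r2 , ≤-refl))

    east∈ : Conn RP Y (r , c2)
    east∈ = proj₂ (Y-component _) (inj₁ (refl , c≤c2 , ≤-refl))

    SWmost∧NEmost⇒r2≤r : NIsSWmost lam mu T k → NIsNEmost lam mu T k → r2 ≤ r
    SWmost∧NEmost⇒r2≤r sw ne = ≤-trans (proj₁ (sw _ (Conn-tgt south∈))) (proj₁ (ne Y Y∈Rp))

    columnEndpoint : c2 ≡ c → Outcome (r2 , c)
    columnEndpoint c2≡c =
      south∈ , inj₂ (inj₁ (r2 , r≤r2 , SameSet-trans Y-component (Hook-column c2≡c r≤r2) , refl))

    rowEndpoint : r2 ≡ r → Outcome (r , c2)
    rowEndpoint r2≡r =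
      east∈ , inj₂ (inj₂ (c2 , c≤c2 , SameSet-trans Y-component (Hook-row r2≡r c≤c2) , refl))

    southEndpoint : NIsSWmost lam mu T k → r < r2 → Outcome (r2 , c)
    southEndpoint sw r<r2 with m≤n⇒m<n∨m≡n c≤c2
    ... | inj₂ c≡c2 = columnEndpoint (sym c≡c2)
    ... | inj₁ c<c2 = south∈ , inj₁ (r2 , c2 , r<r2 , c<c2 , Y-component , inj₁ refl , (λ _ → refl) ,
                        λ ne → contradiction (SWmost∧NEmost⇒r2≤r sw ne) (<⇒≱ r<r2))

    eastEndpoint : NIsNEmost lam mu T k → c < c2 → Outcome (r , c2)
    eastEndpoint ne c<c2 with m≤n⇒m<n∨m≡n r≤r2
    ... | inj₂ r≡r2 = rowEndpoint (sym r≡r2)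
    ... | inj₁ r<r2 = east∈ , inj₁ (r2 , c2 , r<r2 , c<c2 , Y-component , inj₂ refl ,
                        (λ sw → contradiction (SWmost∧NEmost⇒r2≤r sw ne) (<⇒≱ r<r2)) , λ _ → refl)

  endpointOutcome : ∀ {X} → IsSERotationEndpoint lam mu T k X → Outcome X
  endpointOutcome (inj₁ (sw , _ , colMax , inj₁ (r<r′ , refl)))
    with Run-unique colMax (proj₂ columnRun)
  ... | refl = southEndpoint sw r<r′
  endpointOutcome (inj₁ (_ , _ , colMax , inj₂ (r′≡r , _ , rowMax , refl)))
    with Run-unique colMax (proj₂ columnRun) | Run-unique rowMax (proj₂ rowRun)
  ... | refl | refl = rowEndpoint r′≡r
  endpointOutcome (inj₂ (ne , _ , _ , rowMax , inj₁ (c<c′ , refl)))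
    with Run-unique rowMax (proj₂ rowRun)
  ... | refl = eastEndpoint ne c<c′
  endpointOutcome (inj₂ (_ , _ , _ , rowMax , inj₂ (c′≡c , _ , colMax , refl)))
    with Run-unique rowMax (proj₂ rowRun) | Run-unique colMax (proj₂ columnRun)
  ... | refl | refl = columnEndpoint c′≡c

  northeastComponent : ∀ p → RP p → ¬ Conn RP Y p →
                       (∀ q s → Conn RP p q → Conn RP Y s → StrictNE q s) → IsSingleRowRect (Conn RP p)
  northeastComponent p p∈ _ northeast = rowComponent Rp-dec (λ ij∈ → proj₂ (Rp⊆Shape ij∈)) p∈ noVertical
    where
    noVertical : ∀ i j → Conn RP p (i , j) → Conn RP p (suc i , j) → ⊥
    noVertical i j upper lower with northeast _ Y lower (here Y∈Rp)
    ... | i<r , c<j = Rp-noVerticalNE i j (<⇒≤ i<r) (<⇒≤ c<j) (Conn-tgt upper) (Conn-tgt lower)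

  southwestComponent : ∀ p → RP p → ¬ Conn RP Y p →
                       (∀ q s → Conn RP p q → Conn RP Y s → StrictNE s q) → IsSingleColRect (Conn RP p)
  southwestComponent p p∈ _ southwest =
    colComponent Rp-dec (λ ij∈ → InSkew-row<length {lam} {mu} (Rp⊆Shape ij∈)) p∈ noHorizontal
    where
    noHorizontal : ∀ i j → Conn RP p (i , j) → Conn RP p (i , suc j) → ⊥
    noHorizontal i j left right with southwest _ Y right (here Y∈Rp)
    ... | r<i , j<c = Rp-noHorizontalSW i j (<⇒≤ r<i) (<⇒≤ j<c) (Conn-tgt left) (Conn-tgt right)

mainTheorem1 : (lam mu : Partition) → mu ⊆ᴾ lam → (T : SYT lam mu) →
               (k : ℕ) → IsRcSize lam mu T k →
               (X : Cell) → IsSERotationEndpoint lam mu T k X →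
               SERotationConclusion lam mu T k X
mainTheorem1 lam mu _ T k (0<k , k≤n , unimodal , _) X endpoint =
  Rp-isSkewShape , Rp-onBoundary , proj₁ outcome , proj₂ outcome , northeastComponent , southwestComponent
  where
  open SoutheastRotation T 0<k k≤n unimodal
  outcome : Outcome X
  outcome = endpointOutcome endpoint
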